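{- Let $m\geq2$. When $q=1$, every rational number $r$ with $0<r\leq1$ appears at least once as a vertex label in the $(q,0)$-Calkin-Wilf tree of order $m$.
   Context: The $(q,0)$-Calkin-Wilf tree of order $m$ is the infinite complete $m$-ary rooted tree (ordered children: first, ..., $m$-th) whose vertices are labeled by rational functions of $q$ (here evaluated at $q=1$), defined recursively: the root is labeled $\frac11$. For a vertex $v$ with label $\lambda(v)=\frac ab$: each of its first $m-2$ children is labeled $\frac1{1+q}$; its $(m-1)$-st child is labeled $\frac{a}{b+qa}$; its $m$-th child is labeled $\frac{b}{qb+\frac{a}{1+q+\cdots+q^{s-2}+q^{s-1}r}}$, where $v_1=v$, $s\ge1$ is maximal such that there are vertices $v_2,\dots,v_s$ with $v_j$ the $m$-th child of $v_{j+1}$ for $j=1,\dots,s-1$, and $r=\lambda(v_{s+1})$ if $v_s$ is the $(m-1)$-st child of a vertex $v_{s+1}$, $r=1$ otherwise (for $s=1$ the expression $1+q+\cdots+q^{s-2}+q^{s-1}r$ is just $r$). -}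

module Defs where

open import Data.Nat using (ℕ; _∸_)
open import Data.Fin using (Fin; toℕ)
open import Data.List using (List; []; _∷_)
open import Relation.Nullary using (yes; no)
open import Relation.Binary.PropositionalEquality using (_≡_)
open import Data.Rational using (ℚ; 0ℚ; 1ℚ; _+_; _*_; _÷_; ≢-nonZero)
import Data.Nat as ℕ
open import Data.Rational.Properties using (_≟_)

-- Total division on ℚ: x ⊘ y = x / y when y ≠ 0 (and 0 otherwise).
-- All denominators occurring in the tree at q = 1 are positive, so the
-- junk value is never used there.
_⊘_ : ℚ → ℚ → ℚ
x ⊘ y with y ≟ 0ℚ
... | yes _ = 0ℚ
... | no y≢0 = _÷_ x y {{≢-nonZero y≢0}}

-- A vertex of the complete m-ary tree is the list of child indices on the
-- path from the root, listed from the vertex UPWARD: (i ∷ p) is the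
-- (toℕ i + 1)-th child of the vertex p; [] is the root.
Vertex : ℕ → Set
Vertex m = List (Fin m)

-- The three kinds of children (1-based: first m-2, (m-1)-st, m-th).
data Kind : Set where
  early penult last : Kind

kind : (m : ℕ) → Fin m → Kind
kind m i with toℕ i ℕ.≟ (m ∸ 2)
... | yes _ = penult
... | no _ with toℕ i ℕ.≟ (m ∸ 1)
...   | yes _ = last
...   | no _ = early

mutual
  label : (m : ℕ) → ℚ → Vertex m → ℚ
  label m q [] = 1ℚ
  label m q (i ∷ p) = child (kind m i) (label m q p) 1ℚ (tailSum m q p)
    where
    -- label of the child, where the parent's label is a/b and
    -- T = 1 + q + ... + q^(s-2) + q^(s-1) r computed for the parent.
    child : Kind → ℚ → ℚ → ℚ → ℚ
    child early  a b T = 1ℚ ⊘ (1ℚ + q)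
    child penult a b T = a ⊘ (b + q * a)
    child last   a b T = b ⊘ (q * b + (a ⊘ T))

  -- tailSum m q v = 1 + q + ... + q^(s-2) + q^(s-1) r for v = v₁ as in the
  -- definition, by recursion on s:
  --  * v the m-th child of v₂: s(v) = s(v₂)+1 with the same r, so the value
  --    is 1 + q * (value for v₂);
  --  * v the (m-1)-st child of v₂: s = 1, r = λ(v₂);
  --  * otherwise (root or one of the first m-2 children): s = 1, r = 1.
  tailSum : (m : ℕ) → ℚ → Vertex m → ℚ
  tailSum m q [] = 1ℚ
  tailSum m q (i ∷ p) with kind m i
  ... | last   = 1ℚ + q * tailSum m q p
  ... | penult = label m q p
  ... | early  = 1ℚ

-- At q = 1 the (m-1)-st child of a vertex labelled x is labelled φ x = x/(1+x),
-- and its tail sum is x. Going to the m-th child maps (label, tail sum) =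
-- (φ x, x) to (φ (1+x), 1+x), so following j m-th children below the
-- (m-1)-st child of a vertex labelled μ reaches the label φ (j + μ). Every
-- a/b with 0 < a < b is of this form: a/b = φ (a/c) with c = b - a, and
-- a/c = j + t/c with 1 ≤ t ≤ c. Since c < b, t/c is a label by induction on
-- the denominator; the base case a = b is the root.
module Submission where

open import Defs
open import Algebra.Bundles using (Ring)
open import Data.Empty using (⊥-elim)
open import Data.Fin using (Fin; toℕ; fromℕ; inject₁)
open import Data.Fin.Properties using (toℕ-fromℕ; toℕ-inject₁)
open import Data.Integer as ℤ using (+_)
import Data.Integer.Properties as ℤₚ
open import Data.List using ([]; _∷_; replicate; _++_)
open import Data.Nat using (ℕ; zero; suc; _+_; _*_; _∸_; _≤_; _<_; z≤n; s≤s)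
import Data.Nat.Properties as ℕₚ
open import Data.Nat.DivMod using (_/_; _%_; m≡m%n+[m/n]*n; m%n<n)
open import Data.Nat.Induction using (<-rec)
open import Data.Product using (∃; ∃₂; _×_; _,_; proj₁)
open import Data.Sum using (inj₁; inj₂)
open import Data.Rational as ℚ using (ℚ; 0ℚ; 1ℚ; mkℚ; ↥_; ↧ₙ_; 1/_; Positive; NonNegative; ≢-nonZero)
open import Data.Rational.Properties
  using (_≟_; *-assoc; *-identityˡ; *-identityʳ; *-inverseˡ; *-inverseʳ; +-identityˡ; +-assoc; +-comm;
         *-distribʳ-+; <⇒≢; positive⁻¹; pos⇒nonNeg; pos+pos⇒pos; pos+nonNeg⇒pos; nonNeg+pos⇒pos;
         pos*pos⇒pos; 1/pos⇒pos; pos⇒nonZero; drop-*≤*; toℚᵘ-injective; toℚᵘ-homo-+; toℚᵘ-homo-*; +-*-ring)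
open import Data.Rational.Solver using (module +-*-Solver)
import Data.Rational.Unnormalised as ℚᵘ
import Data.Rational.Unnormalised.Properties as ℚᵘₚ
open import Relation.Binary.PropositionalEquality
open import Relation.Nullary using (yes; no)
import Algebra.Properties.Semiring.Mult (Ring.semiring +-*-ring) as Mult

open ≡-Reasoning
open +-*-Solver using (solve; _:+_; _:*_; _:=_; con)

pos⇒≢0 : ∀ p .{{_ : Positive p}} → p ≢ 0ℚ
pos⇒≢0 p = ≢-sym (<⇒≢ (positive⁻¹ p))

*-cancelʳ-≡ : ∀ x y {c} → c ≢ 0ℚ → x ℚ.* c ≡ y ℚ.* c → x ≡ y
*-cancelʳ-≡ x y {c} c≢0 xc≡yc = begin
  x                ≡⟨ undo x ⟨
  x ℚ.* c ℚ.* 1/ c ≡⟨ cong (ℚ._* 1/ c) xc≡yc ⟩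
  y ℚ.* c ℚ.* 1/ c ≡⟨ undo y ⟩
  y                ∎
  where
  instance _ = ≢-nonZero c≢0
  undo : ∀ z → z ℚ.* c ℚ.* 1/ c ≡ z
  undo z = trans (*-assoc z c (1/ c)) (trans (cong (z ℚ.*_) (*-inverseʳ c)) (*-identityʳ z))

⊘-*-cancel : ∀ x {y} → y ≢ 0ℚ → (x ⊘ y) ℚ.* y ≡ x
⊘-*-cancel x {y} y≢0 with y ≟ 0ℚ
... | yes y≡0 = ⊥-elim (y≢0 y≡0)
... | no y≢0′ = trans (*-assoc x _ y) (trans (cong (x ℚ.*_) (*-inverseˡ y)) (*-identityʳ x))
  where instance _ = ≢-nonZero y≢0′

⊘-unique : ∀ {x y w} → y ≢ 0ℚ → w ℚ.* y ≡ x → x ⊘ y ≡ w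
⊘-unique {x} {y} {w} y≢0 wy≡x = *-cancelʳ-≡ (x ⊘ y) w y≢0 (trans (⊘-*-cancel x y≢0) (sym wy≡x))

⊘-pos : ∀ x y .{{_ : Positive x}} .{{_ : Positive y}} → Positive (x ⊘ y)
⊘-pos x y with y ≟ 0ℚ
... | yes y≡0 = ⊥-elim (pos⇒≢0 y y≡0)
... | no _ = pos*pos⇒pos x ((1/ y) {{pos⇒nonZero y}}) {{1/pos⇒pos y}}

⟦_⟧ : ℕ → ℚ
⟦ n ⟧ = n Mult.× 1ℚ

⟦⟧-nonNeg : ∀ n → NonNegative ⟦ n ⟧
⟦⟧-nonNeg zero    = _
⟦⟧-nonNeg (suc n) = pos⇒nonNeg ⟦ suc n ⟧ {{pos+nonNeg⇒pos 1ℚ ⟦ n ⟧ {{⟦⟧-nonNeg n}}}}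

⟦⟧-pos : ∀ {n} → 0 < n → Positive ⟦ n ⟧
⟦⟧-pos {suc n} _ = pos+nonNeg⇒pos 1ℚ ⟦ n ⟧ {{⟦⟧-nonNeg n}}

⟦⟧-linear : ∀ j c t μ → μ ℚ.* ⟦ c ⟧ ≡ ⟦ t ⟧ → (⟦ j ⟧ ℚ.+ μ) ℚ.* ⟦ c ⟧ ≡ ⟦ j * c + t ⟧
⟦⟧-linear j c t μ μc≡t = begin
  (⟦ j ⟧ ℚ.+ μ) ℚ.* ⟦ c ⟧          ≡⟨ *-distribʳ-+ ⟦ c ⟧ ⟦ j ⟧ μ ⟩
  ⟦ j ⟧ ℚ.* ⟦ c ⟧ ℚ.+ μ ℚ.* ⟦ c ⟧  ≡⟨ cong₂ ℚ._+_ (sym (Mult.×1-homo-* j c)) μc≡t ⟩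
  ⟦ j * c ⟧ ℚ.+ ⟦ t ⟧              ≡⟨ Mult.×-homo-+ 1ℚ (j * c) t ⟨
  ⟦ j * c + t ⟧                    ∎

toℚᵘ-⟦⟧ : ∀ n → ℚ.toℚᵘ ⟦ n ⟧ ℚᵘ.≃ ℚᵘ.mkℚᵘ (+ n) 0
toℚᵘ-⟦⟧ zero    = ℚᵘ.*≡* refl
toℚᵘ-⟦⟧ (suc n) = ℚᵘₚ.≃-trans (toℚᵘ-homo-+ 1ℚ ⟦ n ⟧)
  (ℚᵘₚ.≃-trans (ℚᵘₚ.+-congʳ (ℚ.toℚᵘ 1ℚ) (toℚᵘ-⟦⟧ n)) (ℚᵘ.*≡* (trans (ℤₚ.*-identityʳ _)
    (trans (cong (ℤ._+_ ℤ.1ℤ) (ℤₚ.*-identityʳ (+ n))) (sym (ℤₚ.*-identityʳ (+ suc n)))))))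

*-↧ₙ≡↥ : ∀ r → NonNegative r → r ℚ.* ⟦ ↧ₙ r ⟧ ≡ ⟦ ℤ.∣ ↥ r ∣ ⟧
*-↧ₙ≡↥ r@(mkℚ (+ a) d-1 _) _ = toℚᵘ-injective
  (ℚᵘₚ.≃-trans (toℚᵘ-homo-* r ⟦ suc d-1 ⟧)
  (ℚᵘₚ.≃-trans (ℚᵘₚ.*-congˡ {ℚᵘ.mkℚᵘ (+ a) d-1} (toℚᵘ-⟦⟧ (suc d-1)))
  (ℚᵘₚ.≃-trans (ℚᵘ.*≡* (trans (ℤₚ.*-identityʳ (+ a ℤ.* + suc d-1))
                            (cong (ℤ._*_ (+ a)) (cong +_ (sym (ℕₚ.*-identityʳ (suc d-1)))))))
  (ℚᵘₚ.≃-sym (toℚᵘ-⟦⟧ a)))))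

positive≤1-ratio : ∀ r → Positive r → r ℚ.≤ 1ℚ → ∃₂ λ a b → 0 < a × a ≤ b × r ℚ.* ⟦ b ⟧ ≡ ⟦ a ⟧
positive≤1-ratio r@(mkℚ (+ suc a) d-1 _) _ r≤1 =
  suc a , suc d-1 , s≤s z≤n , a≤d , *-↧ₙ≡↥ r _
  where
  a≤d : suc a ≤ suc d-1
  a≤d = ℤₚ.drop‿+≤+ (subst₂ ℤ._≤_ (ℤₚ.*-identityʳ _) (ℤₚ.*-identityˡ _) (drop-*≤* r≤1))

divMod⁺ : ∀ a c → 0 < a → 0 < c → ∃₂ λ j t → 0 < t × t ≤ c × a ≡ j * c + t
divMod⁺ (suc a) c@(suc _) _ _ = a / c , suc (a % c) , s≤s z≤n , m%n<n a c ,
  trans (cong suc (m≡m%n+[m/n]*n a c)) (ℕₚ.+-comm (suc (a % c)) (a / c * c))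

φ : ℚ → ℚ
φ x = x ⊘ (1ℚ ℚ.+ x)

φ-unique : ∀ {x w} .{{_ : Positive x}} → w ℚ.* (1ℚ ℚ.+ x) ≡ x → φ x ≡ w
φ-unique {x} = ⊘-unique (pos⇒≢0 (1ℚ ℚ.+ x) {{pos+pos⇒pos 1ℚ x}})

φ-⊘-self : ∀ x .{{_ : Positive x}} → φ x ⊘ x ≡ 1ℚ ⊘ (1ℚ ℚ.+ x)
φ-⊘-self x = ⊘-unique (pos⇒≢0 x) (sym (φ-unique (begin
  u ℚ.* x ℚ.* s ≡⟨ solve 3 (λ u x s → u :* x :* s := u :* s :* x) refl u x s ⟩
  u ℚ.* s ℚ.* x ≡⟨ cong (ℚ._* x) (⊘-*-cancel 1ℚ (pos⇒≢0 s {{pos+pos⇒pos 1ℚ x}})) ⟩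
  1ℚ ℚ.* x      ≡⟨ *-identityˡ x ⟩
  x             ∎)))
  where
  s = 1ℚ ℚ.+ x
  u = 1ℚ ⊘ s

φ-reciprocal : ∀ y .{{_ : Positive y}} → 1ℚ ⊘ (1ℚ ℚ.+ 1ℚ ⊘ y) ≡ φ y
φ-reciprocal y = ⊘-unique (pos⇒≢0 (1ℚ ℚ.+ 1ℚ ⊘ y) {{pos+pos⇒pos 1ℚ (1ℚ ⊘ y) {{⊘-pos 1ℚ y}}}})
  (*-cancelʳ-≡ (w ℚ.* (1ℚ ℚ.+ 1ℚ ⊘ y)) 1ℚ (pos⇒≢0 y) (begin
    w ℚ.* (1ℚ ℚ.+ 1ℚ ⊘ y) ℚ.* y  ≡⟨ solve 3 (λ w z y → w :* (con 1ℚ :+ z) :* y := w :* (y :+ z :* y))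
                                          refl w (1ℚ ⊘ y) y ⟩
    w ℚ.* (y ℚ.+ 1ℚ ⊘ y ℚ.* y)   ≡⟨ cong (λ z → w ℚ.* (y ℚ.+ z)) (⊘-*-cancel 1ℚ (pos⇒≢0 y)) ⟩
    w ℚ.* (y ℚ.+ 1ℚ)             ≡⟨ cong (w ℚ.*_) (+-comm y 1ℚ) ⟩
    w ℚ.* (1ℚ ℚ.+ y)             ≡⟨ ⊘-*-cancel y (pos⇒≢0 (1ℚ ℚ.+ y) {{pos+pos⇒pos 1ℚ y}}) ⟩
    y                            ≡⟨ *-identityˡ y ⟨
    1ℚ ℚ.* y                     ∎))
  where w = φ y

φ-last-step : ∀ x .{{_ : Positive x}} → 1ℚ ⊘ (1ℚ ℚ.* 1ℚ ℚ.+ φ x ⊘ x) ≡ φ (1ℚ ℚ.+ x)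
φ-last-step x = trans (cong (λ z → 1ℚ ⊘ (1ℚ ℚ.+ z)) (φ-⊘-self x))
                      (φ-reciprocal (1ℚ ℚ.+ x) {{pos+pos⇒pos 1ℚ x}})

φ-ratio : ∀ X {c a r} .{{_ : Positive X}} → c ≢ 0ℚ →
          X ℚ.* c ≡ a → r ℚ.* (c ℚ.+ a) ≡ a → φ X ≡ r
φ-ratio X {c} {a} {r} c≢0 Xc≡a r[c+a]≡a = φ-unique (*-cancelʳ-≡ (r ℚ.* (1ℚ ℚ.+ X)) X c≢0 (begin
  r ℚ.* (1ℚ ℚ.+ X) ℚ.* c   ≡⟨ solve 3 (λ r X c → r :* (con 1ℚ :+ X) :* c := r :* (c :+ X :* c))
                                      refl r X c ⟩
  r ℚ.* (c ℚ.+ X ℚ.* c)    ≡⟨ cong (λ z → r ℚ.* (c ℚ.+ z)) Xc≡a ⟩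
  r ℚ.* (c ℚ.+ a)          ≡⟨ r[c+a]≡a ⟩
  a                        ≡⟨ Xc≡a ⟨
  X ℚ.* c                  ∎))

kind-penult : ∀ m i → toℕ i ≡ m ∸ 2 → kind m i ≡ penult
kind-penult m i i≡m-2 with toℕ i ℕₚ.≟ (m ∸ 2)
... | yes _   = refl
... | no i≢m-2 = ⊥-elim (i≢m-2 i≡m-2)

kind-last : ∀ m i → toℕ i ≢ m ∸ 2 → toℕ i ≡ m ∸ 1 → kind m i ≡ last
kind-last m i i≢m-2 i≡m-1 with toℕ i ℕₚ.≟ (m ∸ 2)
... | yes i≡m-2 = ⊥-elim (i≢m-2 i≡m-2)
... | no _ with toℕ i ℕₚ.≟ (m ∸ 1)
...   | yes _    = refl
...   | no i≢m-1 = ⊥-elim (i≢m-1 i≡m-1)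

module _ (n : ℕ) where

  private
    m = suc (suc n)

  penultChild : Fin m
  penultChild = inject₁ (fromℕ n)

  lastChild : Fin m
  lastChild = fromℕ (suc n)

  Reachable : ℚ → Set
  Reachable r = ∃ λ (v : Vertex m) → label m 1ℚ v ≡ r

  Carries : Vertex m → ℚ → Set
  Carries v x = label m 1ℚ v ≡ φ x × tailSum m 1ℚ v ≡ x

  carries-penult : ∀ p → Carries (penultChild ∷ p) (label m 1ℚ p)
  carries-penult p rewrite kind-penult m penultChild (trans (toℕ-inject₁ (fromℕ n)) (toℕ-fromℕ n)) =
    cong (λ z → label m 1ℚ p ⊘ (1ℚ ℚ.+ z)) (*-identityˡ (label m 1ℚ p)) , refl

  carries-last : ∀ v x .{{_ : Positive x}} → Carries v x → Carries (lastChild ∷ v) (1ℚ ℚ.+ x)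
  carries-last v x (label≡ , tailSum≡)
    rewrite kind-last m lastChild (λ sn≡n → ℕₚ.1+n≢n (trans (sym (toℕ-fromℕ (suc n))) sn≡n))
                                  (toℕ-fromℕ (suc n))
          | label≡ | tailSum≡
    = φ-last-step x , cong (1ℚ ℚ.+_) (*-identityˡ x)

  carries-lasts : ∀ j v x .{{_ : Positive x}} → Carries v x →
                  Carries (replicate j lastChild ++ v) (⟦ j ⟧ ℚ.+ x)
  carries-lasts zero    v x c = subst (Carries v) (sym (+-identityˡ x)) c
  carries-lasts (suc j) v x c =
    subst (Carries (replicate (suc j) lastChild ++ v)) (sym (+-assoc 1ℚ ⟦ j ⟧ x))
      (carries-last (replicate j lastChild ++ v) (⟦ j ⟧ ℚ.+ x) {{nonNeg+pos⇒pos ⟦ j ⟧ {{⟦⟧-nonNeg j}} x}}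
        (carries-lasts j v x c))

  reachable-φ : ∀ j {μ} .{{_ : Positive μ}} → Reachable μ → Reachable (φ (⟦ j ⟧ ℚ.+ μ))
  reachable-φ j (p , refl) =
    replicate j lastChild ++ penultChild ∷ p ,
    proj₁ (carries-lasts j (penultChild ∷ p) (label m 1ℚ p) (carries-penult p))

  ratio-reachable : ∀ b a → 0 < a → a ≤ b → ∀ r → r ℚ.* ⟦ b ⟧ ≡ ⟦ a ⟧ → Reachable r
  ratio-reachable = <-rec Claim step
    where
    Claim : ℕ → Set
    Claim b = ∀ a → 0 < a → a ≤ b → ∀ r → r ℚ.* ⟦ b ⟧ ≡ ⟦ a ⟧ → Reachable r
    step : ∀ b → (∀ {c} → c < b → Claim c) → Claim b
    step b rec a 0<a a≤b r rb≡a with ℕₚ.m≤n⇒m<n∨m≡n a≤b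
    ... | inj₂ refl =
      [] , sym (*-cancelʳ-≡ r 1ℚ (pos⇒≢0 ⟦ a ⟧ {{⟦⟧-pos 0<a}}) (trans rb≡a (sym (*-identityˡ ⟦ a ⟧))))
    ... | inj₁ a<b with divMod⁺ a (b ∸ a) 0<a (ℕₚ.m<n⇒0<n∸m a<b)
    ...   | j , t , 0<t , t≤c , a≡jc+t =
      subst Reachable φ[j+μ]≡r (reachable-φ j (rec (ℕₚ.∸-monoʳ-< 0<a a≤b) t 0<t t≤c μ μc≡t))
      where
      c = b ∸ a
      μ = ⟦ t ⟧ ⊘ ⟦ c ⟧
      instance
        c-pos : Positive ⟦ c ⟧
        c-pos = ⟦⟧-pos (ℕₚ.m<n⇒0<n∸m a<b)
        μ-pos : Positive μ
        μ-pos = ⊘-pos ⟦ t ⟧ ⟦ c ⟧ {{⟦⟧-pos 0<t}}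
        j+μ-pos : Positive (⟦ j ⟧ ℚ.+ μ)
        j+μ-pos = nonNeg+pos⇒pos ⟦ j ⟧ {{⟦⟧-nonNeg j}} μ
      μc≡t : μ ℚ.* ⟦ c ⟧ ≡ ⟦ t ⟧
      μc≡t = ⊘-*-cancel ⟦ t ⟧ (pos⇒≢0 ⟦ c ⟧)
      r[c+a]≡a : r ℚ.* (⟦ c ⟧ ℚ.+ ⟦ a ⟧) ≡ ⟦ a ⟧
      r[c+a]≡a =
        trans (cong (r ℚ.*_) (trans (sym (Mult.×-homo-+ 1ℚ c a)) (cong ⟦_⟧ (ℕₚ.m∸n+n≡m a≤b)))) rb≡a
      φ[j+μ]≡r : φ (⟦ j ⟧ ℚ.+ μ) ≡ r
      φ[j+μ]≡r = φ-ratio (⟦ j ⟧ ℚ.+ μ) (pos⇒≢0 ⟦ c ⟧)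
        (trans (⟦⟧-linear j c t μ μc≡t) (cong ⟦_⟧ (sym a≡jc+t))) r[c+a]≡a

mainTheorem7 : (m : ℕ) → 2 ≤ m → (r : ℚ) → 0ℚ ℚ.< r → r ℚ.≤ 1ℚ →
    ∃ λ (v : Vertex m) → label m 1ℚ v ≡ r
mainTheorem7 (suc (suc n)) (s≤s (s≤s _)) r 0<r r≤1 with positive≤1-ratio r (ℚ.positive 0<r) r≤1
... | a , b , 0<a , a≤b , rb≡a = ratio-reachable n b a 0<a a≤b r rb≡a
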